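{- For every positive integer $n$, $P(n,2) \ge \dfrac{n!}{2^{\lfloor n/2\rfloor}}$.
   Context: A permutation on $\{1,\dots,n\}$ is a sequence listing each element of $\{1,\dots,n\}$ exactly once. The Chebyshev distance between permutations $\sigma,\pi$ is $\max_{i}|\sigma(i)-\pi(i)|$. $P(n,d)$ denotes the maximum cardinality of a set of permutations on $\{1,\dots,n\}$ in which any two distinct permutations have Chebyshev distance at least $d$. -}

module Defs where

open import Data.Nat using (ℕ; _≤_; _∸_; _⊔_; _*_; _^_; _/_)
open import Data.Fin using (Fin; toℕ)
open import Data.Fin.Permutation using (Permutation′; _⟨$⟩ʳ_)
open import Data.Product using (∃; _×_; Σ)
open import Relation.Binary.PropositionalEquality using (_≢_)

absDiff : ℕ → ℕ → ℕ
absDiff a b = (a ∸ b) ⊔ (b ∸ a)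

-- Chebyshev distance between permutations σ, π of Fin n is ≥ d:
-- max_i |σ(i) - π(i)| ≥ d, i.e. some coordinate differs by at least d.
-- (Fin n = {0..n-1} models {1..n}; differences are shift-invariant.)
ChebDistAtLeast : ∀ {n} → ℕ → Permutation′ n → Permutation′ n → Set
ChebDistAtLeast {n} d σ π = ∃ λ (i : Fin n) → d ≤ absDiff (toℕ (σ ⟨$⟩ʳ i)) (toℕ (π ⟨$⟩ʳ i))

IsCode : (n d m : ℕ) → (Fin m → Permutation′ n) → Set
IsCode n d m C = ∀ (j k : Fin m) → j ≢ k → ChebDistAtLeast d (C j) (C k)

-- P(n,d) ≥ m  iff  there exists a code of size m.
PAtLeast : (n d m : ℕ) → Set
PAtLeast n d m = Σ (Fin m → Permutation′ n) (IsCode n d m)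

{-# OPTIONS --safe #-}
-- Let lehmer σ v count the values smaller than v to the right of v in σ. Every sequence c with
-- c v ≤ v is the lehmer sequence of a permutation, built by inserting 0, 1, … in turn. The code
-- consists of the permutations all of whose windows lehmer (2j) + lehmer (2j+1) + lehmer (2j+2)
-- are even: the even entries stay free and each odd entry v keeps (v+1)/2 of its v+1 values, which
-- leaves n! / 2^⌊n/2⌋ codewords.
--
-- If σ ≠ π are at distance one, then π arises from σ by exchanging some pairs of values t, t+1,
-- and these pairs are disjoint. Each exchange changes lehmer t + lehmer (t+1) by one and leaves the
-- entries of unexchanged values alone. So the window around the last exchange of a run
-- (2j, 2j+1), (2j+2, 2j+3), …, or around the first exchange of a run …, (2j-1, 2j), (2j+1, 2j+2),
-- changes parity, and σ and π cannot both be codewords.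

module Submission where

open import Defs
open import Data.Nat using (ℕ; suc; _≤_; _*_; _^_; _/_)
open import Data.Nat using (_!)
open import Data.Product using (∃; _×_)

open import Data.Nat using (zero; _+_; _∸_; _<_; pred; z≤n; s≤s; s≤s⁻¹; ⌊_/2⌋; _%_; parity)
open import Data.Nat.Properties
open import Data.Nat.DivMod using (m%n<n; m/n≡1+[m∸n]/n)
open import Data.Nat.Tactic.RingSolver using (solve-∀)
open import Data.Parity.Base as ℙ using (0ℙ; 1ℙ)
import Data.Parity.Properties as ℙₚ
open import Data.Fin using (Fin; zero; suc; toℕ; fromℕ; fromℕ<; punchIn; remQuot; combine)
import Data.Fin.Properties as Finₚ
open import Data.Fin.Permutation as Perm using (Permutation′; _⟨$⟩ʳ_; _⟨$⟩ˡ_; insert; insert-punchIn)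
open import Data.Vec.Functional using (removeAt)
open import Data.Product using (_,_; proj₁; proj₂; uncurry; swap)
open import Data.Product.Properties using (×-≡,≡→≡)
open import Data.Sum using (_⊎_; inj₁; inj₂; [_,_]′)
open import Data.Bool using (if_then_else_)
open import Function using (_∘_)
open import Function.Bundles using (_⇔_; mk⇔; module Equivalence)
open import Function.Definitions using (Injective)
open import Relation.Nullary using (¬_; Dec; yes; no; does; contradiction)
open import Relation.Nullary.Decidable using (_×-dec_; _⊎-dec_)
open import Relation.Unary using (Decidable)
open import Relation.Binary.PropositionalEquality
  using (_≡_; _≢_; _≗_; refl; sym; trans; cong; cong₂; subst; module ≡-Reasoning)
open import Relation.Binary.Definitions using (tri<; tri≈; tri>)
open import Algebra.Properties.CommutativeMonoid.Sum +-0-commutativeMonoid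
  using (sum; sum-remove; ∑-distrib-+; sum-cong-≗; sum-replicate-zero)

open Equivalence using (to; from)

[_] : {A : Set} → Dec A → ℕ
[ a? ] = if does a? then 1 else 0

[]-yes : {A : Set} (a? : Dec A) → A → [ a? ] ≡ 1
[]-yes (yes _) _ = refl
[]-yes (no ¬a) a = contradiction a ¬a

[]-no : {A : Set} (a? : Dec A) → ¬ A → [ a? ] ≡ 0
[]-no (yes a) ¬a = contradiction a ¬a
[]-no (no _) _ = refl

[]-cong : {A B : Set} (a? : Dec A) (b? : Dec B) → A ⇔ B → [ a? ] ≡ [ b? ]
[]-cong (yes a) b? a⇔b = sym ([]-yes b? (to a⇔b a))
[]-cong (no ¬a) b? a⇔b = sym ([]-no b? (¬a ∘ from a⇔b))

[<?suc] : ∀ m k → [ m <? suc k ] ≡ [ m <? k ] + [ m ≟ k ]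
[<?suc] zero zero = refl
[<?suc] zero (suc k) = refl
[<?suc] (suc m) zero = refl
[<?suc] (suc m) (suc k) = [<?suc] m k

[<?]+[>?] : ∀ {m n} → m ≢ n → [ m <? n ] + [ n <? m ] ≡ 1
[<?]+[>?] {m} {n} m≢n with <-cmp m n
... | tri< m<n _ n≮m = cong₂ _+_ ([]-yes (m <? n) m<n) ([]-no (n <? m) n≮m)
... | tri≈ _ m≡n _ = contradiction m≡n m≢n
... | tri> m≮n _ n<m = cong₂ _+_ ([]-no (m <? n) m≮n) ([]-yes (n <? m) n<m)

sum-zero : ∀ {n} (t : Fin n → ℕ) → (∀ i → t i ≡ 0) → sum t ≡ 0
sum-zero {n} t t≗0 = trans (sum-cong-≗ t≗0) (sum-replicate-zero n)

sum-single : ∀ {n} (t : Fin n → ℕ) p → (∀ i → i ≢ p → t i ≡ 0) → sum t ≡ t p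
sum-single {suc n} t p vanishes = begin
  sum t                       ≡⟨ sum-remove {i = p} t ⟩
  t p + sum (removeAt t p)    ≡⟨ cong (t p +_) (sum-zero _ (λ j → vanishes _ (Finₚ.punchInᵢ≢i p j))) ⟩
  t p + 0                     ≡⟨ +-identityʳ (t p) ⟩
  t p                         ∎
  where open ≡-Reasoning

count-after : ∀ {k} (s : Fin (suc k)) → sum {suc k} (λ i → [ toℕ s <? toℕ i ]) ≡ k ∸ toℕ s
count-after {zero} zero = refl
count-after {suc k} zero = cong suc (count-after {k} zero)
count-after {suc k} (suc s) = count-after s

punchIn-<⇔ : ∀ {n} (s : Fin (suc n)) (p j : Fin n) →
             toℕ (punchIn s p) < toℕ (punchIn s j) ⇔ toℕ p < toℕ j
punchIn-<⇔ s p j = mk⇔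
  (λ lt → ≰⇒> (λ j≤p → <⇒≱ lt (Finₚ.punchIn-mono-≤ s j p j≤p)))
  (λ lt → ≰⇒> (λ le → <⇒≱ lt (Finₚ.punchIn-cancel-≤ s j p le)))

-- The inverse Lehmer code

smallerAfter : ∀ {n} → (Fin n → ℕ) → Fin n → ℕ → ℕ
smallerAfter x p k = sum (λ j → [ toℕ p <? toℕ j ] * [ x j <? k ])

-- The number of smaller values to the right of the value v, i.e. the Lehmer code of x⁻¹
-- (0 if v is not a value of x).
lehmer : ∀ {n} → (Fin n → ℕ) → ℕ → ℕ
lehmer x v = sum (λ i → [ x i ≟ v ] * smallerAfter x i v)

module _ {n} {x : Fin n → ℕ} (x-injective : Injective _≡_ _≡_ x) where

  smallerAfter-suc : ∀ {p q k} → x q ≡ k →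
                     smallerAfter x p (suc k) ≡ smallerAfter x p k + [ toℕ p <? toℕ q ]
  smallerAfter-suc {p} {q} {k} xq≡k = begin
    sum (λ j → [ toℕ p <? toℕ j ] * [ x j <? suc k ])
      ≡⟨ sum-cong-≗ (λ j → cong ([ toℕ p <? toℕ j ] *_) ([<?suc] (x j) k)) ⟩
    sum (λ j → [ toℕ p <? toℕ j ] * ([ x j <? k ] + [ x j ≟ k ]))
      ≡⟨ sum-cong-≗ (λ j → *-distribˡ-+ [ toℕ p <? toℕ j ] [ x j <? k ] [ x j ≟ k ]) ⟩
    sum (λ j → [ toℕ p <? toℕ j ] * [ x j <? k ] + [ toℕ p <? toℕ j ] * [ x j ≟ k ])
      ≡⟨ ∑-distrib-+ (λ j → [ toℕ p <? toℕ j ] * [ x j <? k ]) (λ j → [ toℕ p <? toℕ j ] * [ x j ≟ k ]) ⟩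
    smallerAfter x p k + sum (λ j → [ toℕ p <? toℕ j ] * [ x j ≟ k ])
      ≡⟨ cong (smallerAfter x p k +_) (sum-single _ q elsewhere) ⟩
    smallerAfter x p k + [ toℕ p <? toℕ q ] * [ x q ≟ k ]
      ≡⟨ cong (λ b → smallerAfter x p k + [ toℕ p <? toℕ q ] * b) ([]-yes (x q ≟ k) xq≡k) ⟩
    smallerAfter x p k + [ toℕ p <? toℕ q ] * 1
      ≡⟨ cong (smallerAfter x p k +_) (*-identityʳ _) ⟩
    smallerAfter x p k + [ toℕ p <? toℕ q ]
      ∎
    where
    open ≡-Reasoning
    elsewhere : ∀ j → j ≢ q → [ toℕ p <? toℕ j ] * [ x j ≟ k ] ≡ 0
    elsewhere j j≢q = trans (cong ([ toℕ p <? toℕ j ] *_)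
      ([]-no (x j ≟ k) (λ xj≡k → j≢q (x-injective (trans xj≡k (sym xq≡k))))))
      (*-zeroʳ [ toℕ p <? toℕ j ])

  lehmer-at : ∀ {p v} → x p ≡ v → lehmer x v ≡ smallerAfter x p v
  lehmer-at {p} {v} xp≡v = trans (sum-single _ p elsewhere)
    (trans (cong (_* smallerAfter x p v) ([]-yes (x p ≟ v) xp≡v)) (*-identityˡ _))
    where
    elsewhere : ∀ i → i ≢ p → [ x i ≟ v ] * smallerAfter x i v ≡ 0
    elsewhere i i≢p = cong (_* smallerAfter x i v)
      ([]-no (x i ≟ v) (λ xi≡v → i≢p (x-injective (trans xi≡v (sym xp≡v)))))

lehmer-absent : ∀ {n} (x : Fin n → ℕ) {v} → (∀ i → x i ≢ v) → lehmer x v ≡ 0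
lehmer-absent x {v} x≢v = sum-zero _ (λ i → cong (_* smallerAfter x i v) ([]-no (x i ≟ v) (x≢v i)))

smallerAfter-cong : ∀ {n} {x y : Fin n → ℕ} {k} → (∀ j → x j < k ⇔ y j < k) →
                    ∀ p → smallerAfter x p k ≡ smallerAfter y p k
smallerAfter-cong {x = x} {y} {k} below p =
  sum-cong-≗ (λ j → cong ([ toℕ p <? toℕ j ] *_) ([]-cong (x j <? k) (y j <? k) (below j)))

lehmer-cong : ∀ {n} {x y : Fin n → ℕ} {v} → (∀ i → x i ≡ v ⇔ y i ≡ v) → (∀ j → x j < v ⇔ y j < v) →
              lehmer x v ≡ lehmer y v
lehmer-cong {x = x} {y} {v} at below =
  sum-cong-≗ (λ i → cong₂ _*_ ([]-cong (x i ≟ v) (y i ≟ v) (at i)) (smallerAfter-cong below i))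

lehmer-≗ : ∀ {n} {x y : Fin n → ℕ} → x ≗ y → ∀ v → lehmer x v ≡ lehmer y v
lehmer-≗ x≗y v = lehmer-cong
  (λ i → mk⇔ (trans (sym (x≗y i))) (trans (x≗y i)))
  (λ j → mk⇔ (subst (_< v) (x≗y j)) (subst (_< v) (sym (x≗y j))))

lehmer-removeAt : ∀ {n} (x : Fin (suc n) → ℕ) s {v} → v < x s → lehmer x v ≡ lehmer (removeAt x s) v
lehmer-removeAt x s {v} v<xs = begin
  lehmer x v
    ≡⟨ sum-remove {i = s} (λ i → [ x i ≟ v ] * smallerAfter x i v) ⟩
  [ x s ≟ v ] * smallerAfter x s v + sum (λ j → [ x (punchIn s j) ≟ v ] * smallerAfter x (punchIn s j) v)
    ≡⟨ cong₂ _+_ (cong (_* smallerAfter x s v) ([]-no (x s ≟ v) (>⇒≢ v<xs)))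
                 (sum-cong-≗ (λ j → cong ([ x (punchIn s j) ≟ v ] *_) (smallerAfter-punchIn j))) ⟩
  lehmer (removeAt x s) v
    ∎
  where
  open ≡-Reasoning
  smallerAfter-punchIn : ∀ p → smallerAfter x (punchIn s p) v ≡ smallerAfter (removeAt x s) p v
  smallerAfter-punchIn p = begin
    smallerAfter x (punchIn s p) v
      ≡⟨ sum-remove {i = s} (λ j → [ toℕ (punchIn s p) <? toℕ j ] * [ x j <? v ]) ⟩
    [ toℕ (punchIn s p) <? toℕ s ] * [ x s <? v ] + smallerAfter′
      ≡⟨ cong (λ b → [ toℕ (punchIn s p) <? toℕ s ] * b + smallerAfter′) ([]-no (x s <? v) (<⇒≯ v<xs)) ⟩
    [ toℕ (punchIn s p) <? toℕ s ] * 0 + smallerAfter′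
      ≡⟨ cong (_+ smallerAfter′) (*-zeroʳ [ toℕ (punchIn s p) <? toℕ s ]) ⟩
    smallerAfter′
      ≡⟨ sum-cong-≗ (λ j → cong (_* [ x (punchIn s j) <? v ])
           ([]-cong (toℕ (punchIn s p) <? toℕ (punchIn s j)) (toℕ p <? toℕ j) (punchIn-<⇔ s p j))) ⟩
    smallerAfter (removeAt x s) p v
      ∎
    where
    smallerAfter′ : ℕ
    smallerAfter′ = sum (λ j → [ toℕ (punchIn s p) <? toℕ (punchIn s j) ] * [ x (punchIn s j) <? v ])

lehmer-maximum : ∀ {k} {x : Fin (suc k) → ℕ} → Injective _≡_ _≡_ x → ∀ s → (∀ i → x i ≤ x s) →
                 lehmer x (x s) ≡ k ∸ toℕ s
lehmer-maximum {k} {x} x-injective s maximal = begin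
  lehmer x (x s)
    ≡⟨ lehmer-at x-injective refl ⟩
  smallerAfter x s (x s)
    ≡⟨ sum-cong-≗ termwise ⟩
  sum {suc k} (λ i → [ toℕ s <? toℕ i ])
    ≡⟨ count-after s ⟩
  k ∸ toℕ s
    ∎
  where
  open ≡-Reasoning
  termwise : ∀ i → [ toℕ s <? toℕ i ] * [ x i <? x s ] ≡ [ toℕ s <? toℕ i ]
  termwise i with i Finₚ.≟ s
  ... | yes refl rewrite []-no (toℕ s <? toℕ s) (<-irrefl refl) = refl
  ... | no i≢s = trans (cong ([ toℕ s <? toℕ i ] *_)
                   ([]-yes (x i <? x s) (≤∧≢⇒< (maximal i) (i≢s ∘ x-injective))))
                   (*-identityʳ _)

val : ∀ {n} → Permutation′ n → Fin n → ℕ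
val σ i = toℕ (σ ⟨$⟩ʳ i)

val-injective : ∀ {n} (σ : Permutation′ n) → Injective _≡_ _≡_ (val σ)
val-injective σ eq =
  trans (sym (Perm.inverseˡ σ)) (trans (cong (σ ⟨$⟩ˡ_) (Finₚ.toℕ-injective eq)) (Perm.inverseˡ σ))

val-surjective : ∀ {n} (σ : Permutation′ n) {v} → v < n → ∃ λ i → val σ i ≡ v
val-surjective σ v<n = σ ⟨$⟩ˡ fromℕ< v<n , trans (cong toℕ (Perm.inverseʳ σ)) (Finₚ.toℕ-fromℕ< v<n)

val<n : ∀ {n} (σ : Permutation′ n) i → val σ i < n
val<n σ i = Finₚ.toℕ<n (σ ⟨$⟩ʳ i)

toℕ-punchIn-fromℕ : ∀ {k} (v : Fin k) → toℕ (punchIn (fromℕ k) v) ≡ toℕ v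
toℕ-punchIn-fromℕ zero = refl
toℕ-punchIn-fromℕ (suc v) = cong suc (toℕ-punchIn-fromℕ v)

module _ {k} (s : Fin (suc k)) (σ : Permutation′ k) where

  private
    σ′ : Permutation′ (suc k)
    σ′ = insert s (fromℕ k) σ

  insert-at : val σ′ s ≡ k
  insert-at with s Finₚ.≟ s
  ... | yes _ = Finₚ.toℕ-fromℕ k
  ... | no s≢s = contradiction refl s≢s

  removeAt-insert : removeAt (val σ′) s ≗ val σ
  removeAt-insert j = trans (cong toℕ (insert-punchIn s (fromℕ k) σ j)) (toℕ-punchIn-fromℕ (σ ⟨$⟩ʳ j))

  lehmer-insert-top : lehmer (val σ′) k ≡ k ∸ toℕ s
  lehmer-insert-top = subst (λ m → lehmer (val σ′) m ≡ k ∸ toℕ s) insert-at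
    (lehmer-maximum (val-injective σ′) s
      (λ i → subst (val σ′ i ≤_) (sym insert-at) (m<1+n⇒m≤n (val<n σ′ i))))

  lehmer-insert-below : ∀ {v} → v < k → lehmer (val σ′) v ≡ lehmer (val σ) v
  lehmer-insert-below {v} v<k =
    trans (lehmer-removeAt (val σ′) s (subst (v <_) (sym insert-at) v<k)) (lehmer-≗ removeAt-insert v)

-- Inserting value k at slot k ∸ m of Fin (suc k) leaves exactly m positions after it.
slot : ∀ k → ℕ → Fin (suc k)
slot k m = fromℕ< (s≤s (m∸n≤m k m))

fromLehmer : ∀ n → (ℕ → ℕ) → Permutation′ n
fromLehmer zero c = Perm.id
fromLehmer (suc k) c = insert (slot k (c k)) (fromℕ k) (fromLehmer k c)

lehmer-fromLehmer : ∀ n (c : ℕ → ℕ) {v} → v < n → c v ≤ v → lehmer (val (fromLehmer n c)) v ≡ c v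
lehmer-fromLehmer (suc k) c {v} v<1+k cv≤v with m<1+n⇒m<n∨m≡n v<1+k
... | inj₁ v<k =
  trans (lehmer-insert-below (slot k (c k)) (fromLehmer k c) v<k) (lehmer-fromLehmer k c v<k cv≤v)
... | inj₂ refl = begin
  lehmer (val (fromLehmer (suc v) c)) v  ≡⟨ lehmer-insert-top (slot v (c v)) (fromLehmer v c) ⟩
  v ∸ toℕ (slot v (c v))                  ≡⟨ cong (v ∸_) (Finₚ.toℕ-fromℕ< (s≤s (m∸n≤m v (c v)))) ⟩
  v ∸ (v ∸ c v)                           ≡⟨ m∸[m∸n]≡n cv≤v ⟩
  c v                                     ∎
  where open ≡-Reasoning

-- Permutations at distance one

even-or-odd : ∀ t → ∃ λ j → t ≡ j * 2 ⊎ t ≡ suc (j * 2)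
even-or-odd zero = 0 , inj₁ refl
even-or-odd (suc t) with even-or-odd t
... | j , inj₁ refl = j , inj₂ refl
... | j , inj₂ refl = suc j , inj₁ refl

parity-*2 : ∀ k → parity (k * 2) ≡ 0ℙ
parity-*2 zero = refl
parity-*2 (suc k) = parity-*2 k

parity-1+*2 : ∀ k → parity (suc (k * 2)) ≡ 1ℙ
parity-1+*2 zero = refl
parity-1+*2 (suc k) = parity-1+*2 k

parity-+-*2 : ∀ m k → parity (m + k * 2) ≡ parity m
parity-+-*2 m k =
  trans (ℙₚ.+-homo-+ m (k * 2)) (trans (cong (parity m ℙ.+_) (parity-*2 k)) (ℙₚ.+-identityʳ (parity m)))

window : (ℕ → ℕ) → ℕ → ℕ
window ℓ a = ℓ a + ℓ (suc a) + ℓ (suc (suc a))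

EvenWindows : ℕ → (ℕ → ℕ) → Set
EvenWindows n ℓ = ∀ j → suc (j * 2) < n → parity (window ℓ (j * 2)) ≡ 0ℙ

rising-edge : ∀ {Q : ℕ → Set} → Decidable Q → ¬ Q 0 → ∀ {j} → Q j → ∃ λ k → ¬ Q k × Q (suc k)
rising-edge Q? ¬q₀ {zero} q = contradiction q ¬q₀
rising-edge Q? ¬q₀ {suc j} q with Q? j
... | yes qj = rising-edge Q? ¬q₀ qj
... | no ¬qj = j , ¬qj , q

falling-edge : ∀ {Q : ℕ → Set} → Decidable Q → ∀ d {j} → Q j → ¬ Q (d + j) → ∃ λ k → Q k × ¬ Q (suc k)
falling-edge Q? zero q ¬q = contradiction q ¬q
falling-edge {Q} Q? (suc d) {j} q ¬q with Q? (suc j)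
... | yes q′ = falling-edge Q? d q′ (subst (¬_ ∘ Q) (sym (+-suc d j)) ¬q)
... | no ¬q′ = j , q , ¬q′

Adjacent : ∀ {n} → (Fin n → ℕ) → (Fin n → ℕ) → Set
Adjacent x y = ∀ i → x i ≤ suc (y i) × y i ≤ suc (x i)

adjacent-sym : ∀ {n} {x y : Fin n → ℕ} → Adjacent x y → Adjacent y x
adjacent-sym adjacent = swap ∘ adjacent

Crossing : ∀ {n} → (Fin n → ℕ) → (Fin n → ℕ) → ℕ → Set
Crossing x y t = ∃ λ i → x i < t × t ≤ y i ⊎ y i < t × t ≤ x i

crossing-sym : ∀ {n} {x y : Fin n → ℕ} {t} → Crossing x y t → Crossing y x t
crossing-sym (i , inj₁ c) = i , inj₂ c
crossing-sym (i , inj₂ c) = i , inj₁ c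

crossing? : ∀ {n} (x y : Fin n → ℕ) → Decidable (Crossing x y)
crossing? x y t = Finₚ.any? (λ i → (x i <? t ×-dec t ≤? y i) ⊎-dec (y i <? t ×-dec t ≤? x i))

crossing-of-≢ : ∀ {n} {x y : Fin n → ℕ} {i} → x i ≢ y i → ∃ (Crossing x y)
crossing-of-≢ {x = x} {y} {i} xi≢yi with <-cmp (x i) (y i)
... | tri< xi<yi _ _ = suc (x i) , i , inj₁ (≤-refl , xi<yi)
... | tri≈ _ xi≡yi _ = contradiction xi≡yi xi≢yi
... | tri> _ _ yi<xi = suc (y i) , i , inj₂ (≤-refl , yi<xi)

pinned : ∀ {t u v} → (u < t → v < t) → u < suc t → suc t ≤ v → u ≡ t
pinned {t} below u<1+t 1+t≤v =
  ≤-antisym (m<1+n⇒m≤n u<1+t) (≮⇒≥ (λ u<t → <⇒≱ (below u<t) (≤-trans (n≤1+n t) 1+t≤v)))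

≡-from-bounds : ∀ {m m′ t} → (m′ < t → m < t) → (m < suc t → m′ < suc t) → m ≡ t → m′ ≡ t
≡-from-bounds below below-suc refl = ≤-antisym (m<1+n⇒m≤n (below-suc ≤-refl)) (≮⇒≥ (<-irrefl refl ∘ below))

parity-swapped-pair : ∀ a b u w → u + w ≡ 1 → parity ((a + (b + u)) + (b + (a + w))) ≡ 1ℙ
parity-swapped-pair a b u w u+w≡1 = begin
  parity ((a + (b + u)) + (b + (a + w)))  ≡⟨ cong parity (rearrange a b u w) ⟩
  parity ((u + w) + (a + b) * 2)          ≡⟨ parity-+-*2 (u + w) (a + b) ⟩
  parity (u + w)                          ≡⟨ cong parity u+w≡1 ⟩
  1ℙ                                      ∎
  where
  open ≡-Reasoning
  rearrange : ∀ a b u w → (a + (b + u)) + (b + (a + w)) ≡ (u + w) + (a + b) * 2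
  rearrange = solve-∀

module Crossings {n} (σ π : Permutation′ n) (adjacent : Adjacent (val σ) (val π)) where

  x y : Fin n → ℕ
  x = val σ
  y = val π

  Cross : ℕ → Set
  Cross = Crossing x y

  no-cross-0 : ¬ Cross 0
  no-cross-0 (_ , inj₁ (() , _))
  no-cross-0 (_ , inj₂ (() , _))

  cross⇒< : ∀ {t} → Cross t → t < n
  cross⇒< (i , inj₁ (_ , t≤yi)) = ≤-<-trans t≤yi (val<n π i)
  cross⇒< (i , inj₂ (_ , t≤xi)) = ≤-<-trans t≤xi (val<n σ i)

  no-cross-beyond : ∀ {t} → n ≤ t → ¬ Cross t
  no-cross-beyond n≤t cross = <⇒≱ (cross⇒< cross) n≤t

  below-agree : ∀ {t} → ¬ Cross t → ∀ i → x i < t ⇔ y i < t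
  below-agree ¬cross i = mk⇔
    (λ xi<t → ≰⇒> (λ t≤yi → ¬cross (i , inj₁ (xi<t , t≤yi))))
    (λ yi<t → ≰⇒> (λ t≤xi → ¬cross (i , inj₂ (yi<t , t≤xi))))

  exchanged : ∀ {t i} → ¬ Cross t → Cross (suc t) → x i ≡ t → y i ≡ suc t
  exchanged {t} {i} ¬cross cross xi≡t =
    ≤-antisym (subst (λ m → y i ≤ suc m) xi≡t (proj₂ (adjacent i))) (≤∧≢⇒< t≤yi (yi≢t cross ∘ sym))
    where
    t≤yi : t ≤ y i
    t≤yi = ≮⇒≥ (λ yi<t → <-irrefl xi≡t (from (below-agree ¬cross i) yi<t))
    yi≢t : Cross (suc t) → y i ≢ t
    yi≢t (k , inj₁ (xk<1+t , 1+t≤yk)) yi≡t =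
      1+n≰n (subst (suc t ≤_) (trans (cong y k≡i) yi≡t) 1+t≤yk)
      where
      k≡i : k ≡ i
      k≡i = val-injective σ (trans (pinned (to (below-agree ¬cross k)) xk<1+t 1+t≤yk) (sym xi≡t))
    yi≢t (k , inj₂ (yk<1+t , 1+t≤xk)) yi≡t =
      1+n≰n (subst (suc t ≤_) (trans (cong x k≡i) xi≡t) 1+t≤xk)
      where
      k≡i : k ≡ i
      k≡i = val-injective π (trans (pinned (from (below-agree ¬cross k)) yk<1+t 1+t≤xk) (sym yi≡t))

module _ {n} (σ π : Permutation′ n) (adjacent : Adjacent (val σ) (val π)) where

  open Crossings σ π adjacent
  private
    module Reverse = Crossings π σ (adjacent-sym adjacent)

  exchanged⁻ : ∀ {t i} → ¬ Cross t → Cross (suc t) → x i ≡ suc t → y i ≡ t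
  exchanged⁻ {t} {i} ¬cross cross xi≡1+t with val-surjective π (≤-trans (n≤1+n _) (cross⇒< cross))
  ... | k , yk≡t = trans (cong y (sym k≡i)) yk≡t
    where
    k≡i : k ≡ i
    k≡i = val-injective σ
      (trans (Reverse.exchanged (¬cross ∘ crossing-sym) (crossing-sym cross) yk≡t) (sym xi≡1+t))

  isolated : ∀ {t} → ¬ Cross t → Cross (suc t) → ¬ Cross (suc (suc t))
  isolated {t} ¬cross cross (k , inj₁ (xk<2+t , 2+t≤yk)) =
    1+n≰n (≤-trans (n≤1+n (suc t)) (subst (suc (suc t) ≤_) (exchanged⁻ ¬cross cross xk≡1+t) 2+t≤yk))
    where
    xk≡1+t : x k ≡ suc t
    xk≡1+t = ≤-antisym (m<1+n⇒m≤n xk<2+t) (s≤s⁻¹ (≤-trans 2+t≤yk (proj₂ (adjacent k))))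
  isolated {t} ¬cross cross (k , inj₂ (yk<2+t , 2+t≤xk))
    with val-surjective σ (≤-trans (n≤1+n _) (cross⇒< cross))
  ... | p , xp≡t = 1+n≰n (≤-trans (n≤1+n (suc t)) (subst (suc (suc t) ≤_) (trans (cong x k≡p) xp≡t) 2+t≤xk))
    where
    yk≡1+t : y k ≡ suc t
    yk≡1+t = ≤-antisym (m<1+n⇒m≤n yk<2+t) (s≤s⁻¹ (≤-trans 2+t≤xk (proj₁ (adjacent k))))
    k≡p : k ≡ p
    k≡p = val-injective π (trans yk≡1+t (sym (exchanged ¬cross cross xp≡t)))

  no-consecutive : ∀ t → Cross t → ¬ Cross (suc t)
  no-consecutive zero cross₀ _ = no-cross-0 cross₀
  no-consecutive (suc t) cross cross′ = isolated (λ cross₀ → no-consecutive t cross₀ cross) cross cross′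

  lehmer-fixed : ∀ {t} → ¬ Cross t → ¬ Cross (suc t) → lehmer x t ≡ lehmer y t
  lehmer-fixed ¬cross ¬cross′ = lehmer-cong
    (λ i → mk⇔ (≡-from-bounds (from (below-agree ¬cross i)) (to (below-agree ¬cross′ i)))
               (≡-from-bounds (to (below-agree ¬cross i)) (from (below-agree ¬cross′ i))))
    (below-agree ¬cross)

  lehmer-exchanged : ∀ {t} → ¬ Cross t → Cross (suc t) →
                     parity ((lehmer x t + lehmer x (suc t)) + (lehmer y t + lehmer y (suc t))) ≡ 1ℙ
  lehmer-exchanged {t} ¬cross cross
    with val-surjective σ (≤-trans (n≤1+n _) (cross⇒< cross)) | val-surjective σ (cross⇒< cross)
  ... | p , xp≡t | q , xq≡1+t = begin
    parity ((lehmer x t + lehmer x (suc t)) + (lehmer y t + lehmer y (suc t)))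
      ≡⟨ cong parity (cong₂ _+_ (cong₂ _+_ lehmer-x lehmer-x-suc) (cong₂ _+_ lehmer-y lehmer-y-suc)) ⟩
    parity ((a + (b + [ toℕ q <? toℕ p ])) + (b + (a + [ toℕ p <? toℕ q ])))
      ≡⟨ parity-swapped-pair a b _ _ ([<?]+[>?] (λ q≡p → q≢p (Finₚ.toℕ-injective q≡p))) ⟩
    1ℙ
      ∎
    where
    open ≡-Reasoning
    a b : ℕ
    a = smallerAfter x p t
    b = smallerAfter x q t
    yp≡1+t : y p ≡ suc t
    yp≡1+t = exchanged ¬cross cross xp≡t
    yq≡t : y q ≡ t
    yq≡t = exchanged⁻ ¬cross cross xq≡1+t
    q≢p : q ≢ p
    q≢p q≡p = 1+n≢n (trans (sym xq≡1+t) (trans (cong x q≡p) xp≡t))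
    lehmer-x : lehmer x t ≡ a
    lehmer-x = lehmer-at (val-injective σ) xp≡t
    lehmer-x-suc : lehmer x (suc t) ≡ b + [ toℕ q <? toℕ p ]
    lehmer-x-suc = trans (lehmer-at (val-injective σ) xq≡1+t) (smallerAfter-suc (val-injective σ) xp≡t)
    lehmer-y : lehmer y t ≡ b
    lehmer-y = trans (lehmer-at (val-injective π) yq≡t) (sym (smallerAfter-cong (below-agree ¬cross) q))
    lehmer-y-suc : lehmer y (suc t) ≡ a + [ toℕ p <? toℕ q ]
    lehmer-y-suc = trans (lehmer-at (val-injective π) yp≡1+t)
      (trans (smallerAfter-suc (val-injective π) yq≡t)
             (cong (_+ [ toℕ p <? toℕ q ]) (sym (smallerAfter-cong (below-agree ¬cross) p))))

  window-flip : ∀ {a} → ¬ Cross a → ¬ Cross (3 + a) → Cross (1 + a) ⊎ Cross (2 + a) →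
                parity (window (lehmer x) a + window (lehmer y) a) ≡ 1ℙ
  window-flip {a} ¬cross₀ ¬cross₃ (inj₁ cross₁) = begin
    parity (window (lehmer x) a + window (lehmer y) a)
      ≡⟨ cong (λ m → parity (window (lehmer x) a + (lehmer y a + lehmer y (1 + a) + m)))
              (sym (lehmer-fixed (isolated ¬cross₀ cross₁) ¬cross₃)) ⟩
    parity ((pair x + lehmer x (2 + a)) + (pair y + lehmer x (2 + a)))
      ≡⟨ cong parity (rearrange (pair x) (pair y) (lehmer x (2 + a))) ⟩
    parity ((pair x + pair y) + lehmer x (2 + a) * 2)
      ≡⟨ parity-+-*2 (pair x + pair y) (lehmer x (2 + a)) ⟩
    parity (pair x + pair y)
      ≡⟨ lehmer-exchanged ¬cross₀ cross₁ ⟩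
    1ℙ
      ∎
    where
    open ≡-Reasoning
    pair : (Fin n → ℕ) → ℕ
    pair z = lehmer z a + lehmer z (1 + a)
    rearrange : ∀ p q f → (p + f) + (q + f) ≡ (p + q) + f * 2
    rearrange = solve-∀
  window-flip {a} ¬cross₀ ¬cross₃ (inj₂ cross₂) = begin
    parity (window (lehmer x) a + window (lehmer y) a)
      ≡⟨ cong (λ m → parity (window (lehmer x) a + (m + lehmer y (1 + a) + lehmer y (2 + a))))
              (sym (lehmer-fixed ¬cross₀ ¬cross₁)) ⟩
    parity (window (lehmer x) a + (lehmer x a + lehmer y (1 + a) + lehmer y (2 + a)))
      ≡⟨ cong parity (rearrange (lehmer x a) (lehmer x (1 + a)) (lehmer x (2 + a))
                                (lehmer y (1 + a)) (lehmer y (2 + a))) ⟩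
    parity ((pair x + pair y) + lehmer x a * 2)
      ≡⟨ parity-+-*2 (pair x + pair y) (lehmer x a) ⟩
    parity (pair x + pair y)
      ≡⟨ lehmer-exchanged ¬cross₁ cross₂ ⟩
    1ℙ
      ∎
    where
    open ≡-Reasoning
    pair : (Fin n → ℕ) → ℕ
    pair z = lehmer z (1 + a) + lehmer z (2 + a)
    ¬cross₁ : ¬ Cross (1 + a)
    ¬cross₁ cross₁ = no-consecutive (1 + a) cross₁ cross₂
    rearrange : ∀ f p₁ p₂ q₁ q₂ → (f + p₁ + p₂) + (f + q₁ + q₂) ≡ (p₁ + p₂ + (q₁ + q₂)) + f * 2
    rearrange = solve-∀

  no-exchange-in-window : EvenWindows n (lehmer x) → EvenWindows n (lehmer y) → ∀ k →
                          ¬ Cross (k * 2) → ¬ Cross (3 + k * 2) → ¬ (Cross (1 + k * 2) ⊎ Cross (2 + k * 2))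
  no-exchange-in-window even-x even-y k ¬cross₀ ¬cross₃ cross = 0ℙ≢1ℙ (begin
    0ℙ                                                 ≡⟨ cong₂ ℙ._+_ (even-x k bound) (even-y k bound) ⟨
    parity (window (lehmer x) (k * 2)) ℙ.+ parity (window (lehmer y) (k * 2))
                                                       ≡⟨ ℙₚ.+-homo-+ (window (lehmer x) (k * 2)) _ ⟨
    parity (window (lehmer x) (k * 2) + window (lehmer y) (k * 2))
                                                       ≡⟨ window-flip ¬cross₀ ¬cross₃ cross ⟩
    1ℙ                                                 ∎)
    where
    open ≡-Reasoning
    0ℙ≢1ℙ : 0ℙ ≢ 1ℙ
    0ℙ≢1ℙ ()
    bound : suc (k * 2) < n
    bound = [ cross⇒< , ≤-trans (n≤1+n _) ∘ cross⇒< ]′ cross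

  no-crossing : EvenWindows n (lehmer x) → EvenWindows n (lehmer y) → ∀ t → ¬ Cross t
  no-crossing even-x even-y t cross with even-or-odd t
  ... | j , inj₁ refl with rising-edge (λ k → crossing? x y (k * 2)) no-cross-0 {j} cross
  ...   | k , ¬cross₀ , cross₂ =
    no-exchange-in-window even-x even-y k ¬cross₀ (no-consecutive _ cross₂) (inj₂ cross₂)
  no-crossing even-x even-y t cross | j , inj₂ refl
    with falling-edge (λ k → crossing? x y (suc (k * 2))) n {j} cross
           (no-cross-beyond (≤-trans (m≤m+n n j) (≤-trans (m≤m*n (n + j) 2) (n≤1+n _))))
  ...   | k , cross₁ , ¬cross₃ =
    no-exchange-in-window even-x even-y k (λ cross₀ → no-consecutive _ cross₀ cross₁) ¬cross₃ (inj₁ cross₁)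

  even-windows⇒equal : EvenWindows n (lehmer x) → EvenWindows n (lehmer y) → x ≗ y
  even-windows⇒equal even-x even-y i with x i ≟ y i
  ... | yes xi≡yi = xi≡yi
  ... | no xi≢yi with crossing-of-≢ xi≢yi
  ...   | t , cross = contradiction cross (no-crossing even-x even-y t)

-- The code and its size

parity-+%2 : ∀ m → parity (m + m % 2) ≡ 0ℙ
parity-+%2 zero = refl
parity-+%2 (suc zero) = refl
parity-+%2 (suc (suc m)) = parity-+%2 m

⌊*2+b/2⌋ : ∀ j {b} → b ≤ 1 → ⌊ j * 2 + b /2⌋ ≡ j
⌊*2+b/2⌋ zero z≤n = refl
⌊*2+b/2⌋ zero (s≤s z≤n) = refl
⌊*2+b/2⌋ (suc j) b≤1 = cong suc (⌊*2+b/2⌋ j b≤1)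

⌊1+*2/2⌋ : ∀ j → ⌊ suc (j * 2) /2⌋ ≡ j
⌊1+*2/2⌋ zero = refl
⌊1+*2/2⌋ (suc j) = cong suc (⌊1+*2/2⌋ j)

choices : ℕ → ℕ
choices v with parity v
... | 0ℙ = suc v
... | 1ℙ = suc ⌊ v /2⌋

-- An odd entry keeps a free half 0 ≤ d v ≤ ⌊ v /2⌋; its parity is forced to make the window
-- around it even.
entry : (ℕ → ℕ) → ℕ → ℕ
entry d v with parity v
... | 0ℙ = d v
... | 1ℙ = d v * 2 + (d (pred v) + d (suc v)) % 2

choices-even : ∀ j → choices (j * 2) ≡ suc (j * 2)
choices-even j rewrite parity-*2 j = refl

choices-odd : ∀ j → choices (suc (j * 2)) ≡ suc j
choices-odd j rewrite parity-1+*2 j = cong suc (⌊1+*2/2⌋ j)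

entry-even : ∀ d j → entry d (j * 2) ≡ d (j * 2)
entry-even d j rewrite parity-*2 j = refl

entry-odd : ∀ d j → entry d (suc (j * 2)) ≡ d (suc (j * 2)) * 2 + (d (j * 2) + d (suc j * 2)) % 2
entry-odd d j rewrite parity-1+*2 j = refl

entry≤ : ∀ d v → d v < choices v → entry d v ≤ v
entry≤ d v dv<choices with even-or-odd v
... | j , inj₁ refl rewrite entry-even d j = m<1+n⇒m≤n (subst (d (j * 2) <_) (choices-even j) dv<choices)
... | j , inj₂ refl rewrite entry-odd d j = begin
  d (suc (j * 2)) * 2 + (d (j * 2) + d (suc j * 2)) % 2
    ≤⟨ +-mono-≤ (*-monoˡ-≤ 2 (m<1+n⇒m≤n (subst (d (suc (j * 2)) <_) (choices-odd j) dv<choices)))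
                (m<1+n⇒m≤n (m%n<n (d (j * 2) + d (suc j * 2)) 2)) ⟩
  j * 2 + 1
    ≡⟨ +-comm (j * 2) 1 ⟩
  suc (j * 2)
    ∎
  where open ≤-Reasoning

entry-injective : ∀ d d′ v → entry d v ≡ entry d′ v → d v ≡ d′ v
entry-injective d d′ v eq with even-or-odd v
... | j , inj₁ refl = trans (sym (entry-even d j)) (trans eq (entry-even d′ j))
... | j , inj₂ refl =
  trans (sym (⌊*2+b/2⌋ (d (suc (j * 2))) (m<1+n⇒m≤n (m%n<n (d (j * 2) + d (suc j * 2)) 2))))
    (trans (cong ⌊_/2⌋ (trans (sym (entry-odd d j)) (trans eq (entry-odd d′ j))))
           (⌊*2+b/2⌋ (d′ (suc (j * 2))) (m<1+n⇒m≤n (m%n<n (d′ (j * 2) + d′ (suc j * 2)) 2))))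

entry-window : ∀ d j → parity (window (entry d) (j * 2)) ≡ 0ℙ
entry-window d j = begin
  parity (window (entry d) (j * 2))
    ≡⟨ cong parity (cong₂ _+_ (cong₂ _+_ (entry-even d j) (entry-odd d j)) (entry-even d (suc j))) ⟩
  parity (d₀ + (d₁ * 2 + (d₀ + d₂) % 2) + d₂)
    ≡⟨ cong parity (rearrange d₀ d₁ d₂ ((d₀ + d₂) % 2)) ⟩
  parity ((d₀ + d₂ + (d₀ + d₂) % 2) + d₁ * 2)
    ≡⟨ parity-+-*2 (d₀ + d₂ + (d₀ + d₂) % 2) d₁ ⟩
  parity (d₀ + d₂ + (d₀ + d₂) % 2)
    ≡⟨ parity-+%2 (d₀ + d₂) ⟩
  0ℙ
    ∎
  where
  open ≡-Reasoning
  d₀ d₁ d₂ : ℕ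
  d₀ = d (j * 2)
  d₁ = d (suc (j * 2))
  d₂ = d (suc j * 2)
  rearrange : ∀ a b c r → a + (b * 2 + r) + c ≡ (a + c + r) + b * 2
  rearrange = solve-∀

codeSize : ℕ → ℕ
codeSize zero = 1
codeSize (suc n) = codeSize n * choices n

split : ∀ n → Fin (codeSize (suc n)) → Fin (codeSize n) × Fin (choices n)
split n = remQuot {codeSize n} (choices n)

split-injective : ∀ n {i j} → split n i ≡ split n j → i ≡ j
split-injective n {i} {j} eq = begin
  i                            ≡⟨ Finₚ.combine-remQuot {codeSize n} (choices n) i ⟨
  uncurry combine (split n i)  ≡⟨ cong (uncurry combine) eq ⟩
  uncurry combine (split n j)  ≡⟨ Finₚ.combine-remQuot {codeSize n} (choices n) j ⟩
  j                            ∎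
  where open ≡-Reasoning

digits : ∀ n → Fin (codeSize n) → ℕ → ℕ
digits zero _ _ = 0
digits (suc n) i v with v ≟ n
... | yes _ = toℕ (proj₂ (split n i))
... | no _ = digits n (proj₁ (split n i)) v

digits-top : ∀ n i → digits (suc n) i n ≡ toℕ (proj₂ (split n i))
digits-top n i with n ≟ n
... | yes _ = refl
... | no n≢n = contradiction refl n≢n

digits-≢ : ∀ n i {v} → v ≢ n → digits (suc n) i v ≡ digits n (proj₁ (split n i)) v
digits-≢ n i {v} v≢n with v ≟ n
... | yes v≡n = contradiction v≡n v≢n
... | no _ = refl

digits<choices : ∀ n i {v} → v < n → digits n i v < choices v
digits<choices (suc n) i {v} v<1+n with m<1+n⇒m<n∨m≡n v<1+n
... | inj₁ v<n = subst (_< choices v) (sym (digits-≢ n i (<⇒≢ v<n))) (digits<choices n _ v<n)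
... | inj₂ refl = subst (_< choices v) (sym (digits-top v i)) (Finₚ.toℕ<n _)

digits-beyond : ∀ n i {v} → n ≤ v → digits n i v ≡ 0
digits-beyond zero i n≤v = refl
digits-beyond (suc n) i n<v = trans (digits-≢ n i (>⇒≢ n<v)) (digits-beyond n _ (≤-trans (n≤1+n n) n<v))

digits-injective : ∀ n {i i′} → (∀ v → v < n → digits n i v ≡ digits n i′ v) → i ≡ i′
digits-injective zero {zero} {zero} _ = refl
digits-injective (suc n) {i} {i′} same = split-injective n (×-≡,≡→≡ (quotients , remainders))
  where
  quotients : proj₁ (split n i) ≡ proj₁ (split n i′)
  quotients = digits-injective n (λ v v<n →
    trans (sym (digits-≢ n i (<⇒≢ v<n))) (trans (same v (≤-trans v<n (n≤1+n n))) (digits-≢ n i′ (<⇒≢ v<n))))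
  remainders : proj₂ (split n i) ≡ proj₂ (split n i′)
  remainders = Finₚ.toℕ-injective (trans (sym (digits-top n i)) (trans (same n ≤-refl) (digits-top n i′)))

code : ∀ n → Fin (codeSize n) → Permutation′ n
code n i = fromLehmer n (entry (digits n i))

lehmer-code : ∀ n i {v} → v < n → lehmer (val (code n i)) v ≡ entry (digits n i) v
lehmer-code n i {v} v<n =
  lehmer-fromLehmer n (entry (digits n i)) v<n (entry≤ (digits n i) v (digits<choices n i v<n))

code-evenWindows : ∀ n i → EvenWindows n (lehmer (val (code n i)))
code-evenWindows n i j 1+2j<n = trans (cong parity same-window) (entry-window (digits n i) j)
  where
  last : lehmer (val (code n i)) (suc j * 2) ≡ entry (digits n i) (suc j * 2)
  last with m≤n⇒m<n∨m≡n 1+2j<n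
  ... | inj₁ 2+2j<n = lehmer-code n i 2+2j<n
  ... | inj₂ 2+2j≡n =
    trans (lehmer-absent (val (code n i)) (λ p eq → <-irrefl (trans eq 2+2j≡n) (val<n (code n i) p)))
          (sym (trans (entry-even (digits n i) (suc j)) (digits-beyond n i (≤-reflexive (sym 2+2j≡n)))))
  same-window : window (lehmer (val (code n i))) (j * 2) ≡ window (entry (digits n i)) (j * 2)
  same-window =
    cong₂ _+_ (cong₂ _+_ (lehmer-code n i (≤-trans (n≤1+n _) 1+2j<n)) (lehmer-code n i 1+2j<n)) last

code-injective : ∀ n {i i′} → val (code n i) ≗ val (code n i′) → i ≡ i′
code-injective n {i} {i′} same = digits-injective n (λ v v<n →
  entry-injective (digits n i) (digits n i′) v
    (trans (sym (lehmer-code n i v<n)) (trans (lehmer-≗ same v) (lehmer-code n i′ v<n))))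

∸<2⇒≤1+ : ∀ a b → a ∸ b < 2 → a ≤ suc b
∸<2⇒≤1+ zero b _ = z≤n
∸<2⇒≤1+ (suc a) zero a∸b<2 = s≤s⁻¹ a∸b<2
∸<2⇒≤1+ (suc a) (suc b) a∸b<2 = s≤s (∸<2⇒≤1+ a b a∸b<2)

absDiff<2⇒adjacent : ∀ a b → absDiff a b < 2 → a ≤ suc b × b ≤ suc a
absDiff<2⇒adjacent a b close =
  ∸<2⇒≤1+ a b (≤-<-trans (m≤m⊔n (a ∸ b) (b ∸ a)) close) ,
  ∸<2⇒≤1+ b a (≤-<-trans (m≤n⊔m (a ∸ b) (b ∸ a)) close)

code-isCode : ∀ n → IsCode n 2 (codeSize n) (code n)
code-isCode n i i′ i≢i′ with Finₚ.any? (λ p → 2 ≤? absDiff (val (code n i) p) (val (code n i′) p))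
... | yes far = far
... | no ¬far = contradiction (code-injective n equal) i≢i′
  where
  adjacent : Adjacent (val (code n i)) (val (code n i′))
  adjacent p = absDiff<2⇒adjacent _ _ (≰⇒> (λ 2≤ → ¬far (p , 2≤)))
  equal : val (code n i) ≗ val (code n i′)
  equal = even-windows⇒equal (code n i) (code n i′) adjacent (code-evenWindows n i) (code-evenWindows n i′)

⌊*2/2⌋ : ∀ j → ⌊ j * 2 /2⌋ ≡ j
⌊*2/2⌋ zero = refl
⌊*2/2⌋ (suc j) = cong suc (⌊*2/2⌋ j)

/2≡⌊/2⌋ : ∀ n → n / 2 ≡ ⌊ n /2⌋
/2≡⌊/2⌋ zero = refl
/2≡⌊/2⌋ (suc zero) = refl
/2≡⌊/2⌋ (suc (suc n)) = trans (m/n≡1+[m∸n]/n {suc (suc n)} {2} (s≤s (s≤s z≤n))) (cong suc (/2≡⌊/2⌋ n))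

choices-step : ∀ v → choices v * 2 ^ ⌊ suc v /2⌋ ≡ suc v * 2 ^ ⌊ v /2⌋
choices-step v with even-or-odd v
... | j , inj₁ refl rewrite choices-even j | ⌊1+*2/2⌋ j | ⌊*2/2⌋ j = refl
... | j , inj₂ refl rewrite choices-odd j | ⌊1+*2/2⌋ j | ⌊*2/2⌋ j = regroup j (2 ^ j)
  where
  regroup : ∀ j p → suc j * (2 * p) ≡ suc (suc (j * 2)) * p
  regroup = solve-∀

codeSize*2^⌊n/2⌋≡n! : ∀ n → codeSize n * 2 ^ ⌊ n /2⌋ ≡ n !
codeSize*2^⌊n/2⌋≡n! zero = refl
codeSize*2^⌊n/2⌋≡n! (suc n) = begin
  codeSize n * choices n * 2 ^ ⌊ suc n /2⌋    ≡⟨ *-assoc (codeSize n) (choices n) _ ⟩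
  codeSize n * (choices n * 2 ^ ⌊ suc n /2⌋)  ≡⟨ cong (codeSize n *_) (choices-step n) ⟩
  codeSize n * (suc n * 2 ^ ⌊ n /2⌋)          ≡⟨ *-comm-middle (codeSize n) (suc n) (2 ^ ⌊ n /2⌋) ⟩
  suc n * (codeSize n * 2 ^ ⌊ n /2⌋)          ≡⟨ cong (suc n *_) (codeSize*2^⌊n/2⌋≡n! n) ⟩
  suc n * n !                              ∎
  where
  open ≡-Reasoning
  *-comm-middle : ∀ a b c → a * (b * c) ≡ b * (a * c)
  *-comm-middle = solve-∀

corollary3 : ∀ (n : ℕ) → 1 ≤ n →
    ∃ λ (m : ℕ) → PAtLeast n 2 m × (n ! ≤ m * 2 ^ (n / 2))
corollary3 n _ = codeSize n , (code n , code-isCode n) ,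
  ≤-reflexive (trans (sym (codeSize*2^⌊n/2⌋≡n! n)) (cong (λ e → codeSize n * 2 ^ e) (sym (/2≡⌊/2⌋ n))))
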